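{- For all positive integers $m\le n$, the $3$-cut complex $\Delta_3(G(m,n))$ of the grid graph $G(m,n)$ is shellable.
   Context: The grid graph $G(m,n)$ has vertex set $\{(i,j):1\le i\le m,1\le j\le n\}$, with edges $\{(i,j),(i+1,j)\}$ for $1\le i\le m-1$, $1\le j\le n$ and $\{(i,j),(i,j+1)\}$ for $1\le i\le m$, $1\le j\le n-1$. For a graph $G=(V,E)$ with $|V|=N$ and $k\ge 2$, the $k$-cut complex $\Delta_k(G)$ is the simplicial complex on $V$ whose facets are the subsets $F\subseteq V$ with $|F|=N-k$ such that the induced subgraph $G[V\setminus F]$ is disconnected (void if there are none). A simplicial complex is shellable if its facets admit an ordering $F_1,\dots,F_t$ such that for each $1<j\le t$, $\bigl(\bigcup_{i<j}\langle F_i\rangle\bigr)\cap\langle F_j\rangle$ is a complex all of whose facets have cardinality $|F_j|-1$; by convention the void complex is shellable. -}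

module Defs where

open import Data.Nat using (ℕ; zero; suc; _*_; _∸_; _≤_; _<_)
open import Data.Fin using (Fin; toℕ; remQuot)
open import Data.Fin.Subset using (Subset; _∈_; _⊆_; ∁; ∣_∣)
open import Data.Product using (_×_; Σ; ∃; proj₁; proj₂; _,_)
open import Data.Sum using (_⊎_)
open import Data.List using (List; length; lookup)
open import Data.List.Membership.Propositional using () renaming (_∈_ to _∈ₗ_)
open import Data.List.Relation.Unary.Unique.Propositional using (Unique)
open import Relation.Binary.PropositionalEquality using (_≡_)
open import Relation.Nullary using (¬_)

record Graph (N : ℕ) : Set₁ where
  field
    Adj : Fin N → Fin N → Set

open Graph public

data WalkIn {N : ℕ} (G : Graph N) (S : Subset N) : Fin N → Fin N → Set where
  here : ∀ {u} → u ∈ S → WalkIn G S u u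
  step : ∀ {u w v} → u ∈ S → Adj G u w → WalkIn G S w v → WalkIn G S u v

InducedConnected : {N : ℕ} → Graph N → Subset N → Set
InducedConnected G S = ∀ u v → u ∈ S → v ∈ S → WalkIn G S u v

InducedDisconnected : {N : ℕ} → Graph N → Subset N → Set
InducedDisconnected G S = ¬ InducedConnected G S

IsCutFacet : {N : ℕ} → ℕ → Graph N → Subset N → Set
IsCutFacet {N} k G F = (∣ F ∣ ≡ N ∸ k) × InducedDisconnected G (∁ F)

-- A shelling order: a duplicate-free list of exactly the facets,
-- F_1, ..., F_t, such that for every j > 1 (0-based: toℕ j ≥ 1) all facets
-- of the complex (⋃_{i<j} ⟨F_i⟩) ∩ ⟨F_j⟩ have cardinality |F_j| - 1.
module _ {N : ℕ} (Fs : List (Subset N)) (j : Fin (length Fs)) where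

  IntersectionFace : Subset N → Set
  IntersectionFace σ =
    (σ ⊆ lookup Fs j) × Σ (Fin (length Fs)) (λ i → (toℕ i < toℕ j) × (σ ⊆ lookup Fs i))

  IntersectionFacet : Subset N → Set
  IntersectionFacet σ =
    IntersectionFace σ × (∀ τ → IntersectionFace τ → σ ⊆ τ → τ ≡ σ)

IsShellingOrder : {N : ℕ} → (Subset N → Set) → List (Subset N) → Set
IsShellingOrder {N} Facet Fs =
  Unique Fs
  × (∀ F → Facet F → F ∈ₗ Fs)
  × (∀ F → F ∈ₗ Fs → Facet F)
  × (∀ (j : Fin (length Fs)) → 1 ≤ toℕ j →
       ∀ σ → IntersectionFacet Fs j σ → ∣ σ ∣ ≡ ∣ lookup Fs j ∣ ∸ 1)

-- Shellable (the void complex, with no facets, is shellable via the empty list).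
Shellable : {N : ℕ} → (Subset N → Set) → Set
Shellable {N} Facet = Σ (List (Subset N)) (IsShellingOrder Facet)

-- Grid graph G(m,n): vertex v : Fin (m * n) is identified with the pair
-- (i , j) = remQuot n v : Fin m × Fin n (0-based indices).

gridGraph : (m n : ℕ) → Graph (m * n)
Adj (gridGraph m n) u v =
  let i  = proj₁ (remQuot {m} n u)
      j  = proj₂ (remQuot {m} n u)
      i' = proj₁ (remQuot {m} n v)
      j' = proj₂ (remQuot {m} n v)
  in ((suc (toℕ i) ≡ toℕ i' ⊎ suc (toℕ i') ≡ toℕ i) × j ≡ j')
     ⊎ (i ≡ i' × (suc (toℕ j) ≡ toℕ j' ⊎ suc (toℕ j') ≡ toℕ j))

cutComplex : {N : ℕ} → ℕ → Graph N → Subset N → Set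
cutComplex k G = IsCutFacet k G

-- Facets of Δ₃(G) are the complements of 3-sets T with G[T] disconnected.  The grid is bipartite,
-- hence triangle-free, so G[T] is connected exactly when some vertex of T is adjacent to the other two.
-- Write T = {a < b < c} in row-major order and order these triples by c, then by the row of b, then
-- with a ≁ b before a ~ b.  In complement form the shelling condition asks, for T′ before T, for some
-- y ∈ T′ ∖ T that replaces a vertex of T to give an earlier disconnected triple (when T′ ∖ T = {y},
-- T′ itself is one).  Replacing c by y lowers the top vertex, so it fails only if {a, b, y} is
-- connected.  Then, if a ~ b, y is adjacent to exactly one of a, b and replacing that one by y isolates
-- the other; if a ≁ b, y is adjacent to both and replacing b by y may isolate c.  This yields an
-- earlier triple except in rigid local configurations (y directly below a or b, or a, b diagonal with
-- y one of their two common neighbours), and two distinct such y in T′ ∖ T would make T′ connected or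
-- put it after T.

module Submission where

open import Defs
open import Data.Nat using (ℕ; zero; suc; _*_; _+_; _∸_; _≤_; _<_; z≤n; s≤s; parity)
open import Data.Nat.Properties
  using ( _≟_; _≤?_; _<?_; ≤-decTotalOrder; ≤-refl; ≤-reflexive; ≤-trans; ≤-antisym; ≤-<-trans; <-≤-trans
        ; <-trans; <-irrefl; <-asym; <-cmp; <⇒≤; <⇒≱; ≮⇒≥; ≰⇒>; ≤∧≢⇒<; m<1+n⇒m≤n; n<1+n; n≤1+n; 1+n≢n
        ; suc-injective; +-comm; +-suc; +-cancelʳ-≡; +-monoˡ-≤; +-monoʳ-≤; +-monoʳ-<; *-suc; *-monoʳ-≤; *-mono-≤
        ; m≤m+n; ∸-+-assoc; m∸[m∸n]≡n; module ≤-Reasoning)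
open import Data.Fin using (Fin; zero; suc; toℕ; cast; remQuot; combine)
import Data.Fin.Properties as Finₚ
open import Data.Fin.Properties using (toℕ-injective; toℕ-cast; toℕ<n; combine-remQuot; toℕ-combine)
open import Data.Fin.Subset using (Subset; _∈_; _∉_; _⊆_; ∁; ∣_∣; _∩_; _∪_; ⁅_⁆; inside; outside)
open import Data.Fin.Subset.Properties
  using (x∈p∩q⁺; x∈p∩q⁻; p∩q⊆p; p∩q⊆q; x∈p∪q⁺; x∈p∪q⁻; x∈⁅x⁆; x∈⁅y⁆⇒x≡y; ∣⁅x⁆∣≡1; ∪-identityˡ;
         x∈∁p⇒x∉p; x∉p⇒x∈∁p; x∉∁p⇒x∈p; x∈p⇒x∉∁p; ∣∁p∣≡n∸∣p∣; ⊆-antisym; drop-∷-⊆; p⊆q⇒∣p∣≤∣q∣)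
open import Data.Vec.Base using ([]; _∷_; here; there)
open import Data.Product using (_×_; ∃-syntax; proj₁; proj₂; _,_; uncurry)
open import Data.Sum using (_⊎_; inj₁; inj₂)
import Data.Sum as Sum
open import Data.Parity.Base using (Parity; _⁻¹)
open import Data.Parity.Properties using (suc-homo-⁻¹; ⁻¹-selfInverse; ⁻¹-involutive; p≢p⁻¹)
open import Data.List using (List; []; _∷_; length; lookup; map; filter; cartesianProduct; allFin)
open import Data.List.Properties using (length-map)
open import Data.List.Membership.Propositional using () renaming (_∈_ to _∈ₗ_)
open import Data.List.Membership.Propositional.Properties
  using (∈-map⁺; ∈-map⁻; ∈-lookup; ∈-filter⁺; ∈-filter⁻; ∈-cartesianProduct⁺; ∈-allFin)
open import Data.List.Relation.Unary.All using (All; []; _∷_)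
import Data.List.Relation.Unary.All as All
import Data.List.Relation.Unary.All.Properties as Allₚ
open import Data.List.Relation.Unary.Any using (index)
import Data.List.Relation.Unary.Any as Any
open import Data.List.Relation.Unary.Any.Properties using (lookup-index)
open import Data.List.Relation.Unary.AllPairs using (AllPairs; []; _∷_)
import Data.List.Relation.Unary.AllPairs as AllPairs
import Data.List.Relation.Unary.AllPairs.Properties as AllPairsₚ
open import Data.List.Relation.Unary.Unique.Propositional using (Unique)
import Data.List.Relation.Unary.Unique.Propositional.Properties as Uniqueₚ
open import Data.List.Relation.Unary.Linked.Properties using (Linked⇒AllPairs)
open import Data.List.Relation.Binary.Permutation.Propositional using (↭-sym; ↭⇒↭ₛ)
open import Data.List.Relation.Binary.Permutation.Propositional.Properties using (∈-resp-↭)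
import Data.List.Relation.Binary.Permutation.Setoid.Properties as Permutationₛ
import Data.List.Sort as Sort
import Relation.Binary.Construct.On as On
open import Relation.Binary.PropositionalEquality
  using (_≡_; _≢_; refl; sym; trans; cong; subst; subst₂; cong₂; setoid; module ≡-Reasoning)
open import Relation.Nullary using (¬_; Dec; yes; no)
open import Relation.Nullary.Decidable using (_×-dec_; _⊎-dec_)
open import Relation.Binary.Definitions using (tri<; tri≈; tri>)
open import Data.Empty using (⊥; ⊥-elim)
open import Function using (_∘_; id)

module _ {A : Set} where

  All-lookup : ∀ {P : A → Set} {xs} → All P xs → (i : Fin (length xs)) → P (lookup xs i)
  All-lookup (px ∷ _)   zero    = px
  All-lookup (_  ∷ pxs) (suc i) = All-lookup pxs i

  AllPairs-lookup : ∀ {R : A → A → Set} {xs} → AllPairs R xs →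
                    {i j : Fin (length xs)} → toℕ i < toℕ j → R (lookup xs i) (lookup xs j)
  AllPairs-lookup (rx ∷ _)   {zero}  {suc j} _         = All-lookup rx j
  AllPairs-lookup (_  ∷ rxs) {suc i} {suc j} (s≤s i<j) = AllPairs-lookup rxs i<j

  AllPairs-weaken : ∀ {P : A → Set} {R S : A → A → Set} {xs} →
                    (∀ {x y} → P x → P y → R x y → S x y) → All P xs → AllPairs R xs → AllPairs S xs
  AllPairs-weaken weaken []         []         = []
  AllPairs-weaken weaken (px ∷ pxs) (rx ∷ rxs) =
    All.zipWith (λ (py , r) → weaken px py r) (pxs , rx) ∷ AllPairs-weaken weaken pxs rxs

  lookup-map : ∀ {B : Set} (f : A → B) xs (i : Fin (length (map f xs))) (j : Fin (length xs)) →
               toℕ i ≡ toℕ j → lookup (map f xs) i ≡ f (lookup xs j)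
  lookup-map f (x ∷ xs) zero    zero    _  = refl
  lookup-map f (x ∷ xs) (suc i) (suc j) eq = lookup-map f xs i j (suc-injective eq)

  sorted-lookup-< : ∀ (key : A → ℕ) {xs} → AllPairs (λ x y → key x ≤ key y) xs →
                    {i j : Fin (length xs)} → key (lookup xs i) < key (lookup xs j) → toℕ i < toℕ j
  sorted-lookup-< key {xs} sorted {i} {j} lt with toℕ j ≤? toℕ i
  ... | no  j≰i = ≰⇒> j≰i
  ... | yes j≤i with toℕ j ≟ toℕ i
  ...   | yes j≡i = ⊥-elim (<-irrefl (cong (key ∘ lookup xs) (toℕ-injective (sym j≡i))) lt)
  ...   | no  j≢i = ⊥-elim (<⇒≱ lt (AllPairs-lookup sorted (≤∧≢⇒< j≤i j≢i)))

-- Shelling orders from an exchange property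

module _ {N : ℕ} where

  -- The exchange form of the shelling condition: Fₖ ∩ Fⱼ is a codimension-one face of Fⱼ containing Fᵢ ∩ Fⱼ.
  Bridge : Subset N → Subset N → Subset N → Set
  Bridge Fᵢ Fⱼ Fₖ = (Fᵢ ∩ Fⱼ ⊆ Fₖ ∩ Fⱼ) × (∣ Fₖ ∩ Fⱼ ∣ ≡ ∣ Fⱼ ∣ ∸ 1)

  Bridge-cong : ∀ {F F′ G G′ H H′} → F ≡ F′ → G ≡ G′ → H ≡ H′ → Bridge F G H → Bridge F′ G′ H′
  Bridge-cong refl refl refl bridge = bridge

module _ {N : ℕ} (Fs : List (Subset N)) where

  ExchangeAt : Fin (length Fs) → Fin (length Fs) → Set
  ExchangeAt i j = ∃[ k ] toℕ k < toℕ j × Bridge (lookup Fs i) (lookup Fs j) (lookup Fs k)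

  intersectionFacet-card : (∀ {i j} → toℕ i < toℕ j → ExchangeAt i j) →
                           ∀ j σ → IntersectionFacet Fs j σ → ∣ σ ∣ ≡ ∣ lookup Fs j ∣ ∸ 1
  intersectionFacet-card exchange j σ ((σ⊆Fⱼ , i , i<j , σ⊆Fᵢ) , maximal)
    with exchange i<j
  ... | k , k<j , Fᵢ∩Fⱼ⊆Fₖ∩Fⱼ , ∣Fₖ∩Fⱼ∣ = trans (cong ∣_∣ (sym Fₖ∩Fⱼ≡σ)) ∣Fₖ∩Fⱼ∣
    where
    Fₖ∩Fⱼ≡σ : lookup Fs k ∩ lookup Fs j ≡ σ
    Fₖ∩Fⱼ≡σ = maximal _ (p∩q⊆q _ _ , k , k<j , p∩q⊆p _ _)
                         (λ x∈σ → Fᵢ∩Fⱼ⊆Fₖ∩Fⱼ (x∈p∩q⁺ (σ⊆Fᵢ x∈σ , σ⊆Fⱼ x∈σ)))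

module _ {N : ℕ} {C : Set} (facet : C → Subset N) (key : C → ℕ) (ts : List C) where

  KeyedExchange : Set
  KeyedExchange = ∀ {s t} → s ∈ₗ ts → t ∈ₗ ts → facet s ≢ facet t → key s ≤ key t →
    ∃[ u ] u ∈ₗ ts × Bridge (facet s) (facet t) (facet u) × (key u < key t ⊎ u ≡ s)

  module _ (sorted : AllPairs (λ s t → key s ≤ key t) ts)
           (distinct : AllPairs (λ s t → facet s ≢ facet t) ts)
           (exchange : KeyedExchange) where

    keyedExchangeAt : ∀ {i j} → toℕ i < toℕ j → ∃[ k ] toℕ k < toℕ j ×
                      Bridge (facet (lookup ts i)) (facet (lookup ts j)) (facet (lookup ts k))
    keyedExchangeAt {i} {j} i<j
      with exchange (∈-lookup i) (∈-lookup j) (AllPairs-lookup distinct i<j) (AllPairs-lookup sorted i<j)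
    ... | _ , _    , bridge , inj₂ refl = i , i<j , bridge
    ... | _ , u∈ts , bridge , inj₁ u<t =
      index u∈ts , sorted-lookup-< key sorted (subst (λ u → key u < _) (lookup-index u∈ts) u<t)
                 , Bridge-cong refl refl (cong facet (lookup-index u∈ts)) bridge

    private
      fromMap : Fin (length (map facet ts)) → Fin (length ts)
      fromMap = cast (length-map facet ts)

      toMap : Fin (length ts) → Fin (length (map facet ts))
      toMap = cast (sym (length-map facet ts))

      toℕ-fromMap : ∀ i → toℕ (fromMap i) ≡ toℕ i
      toℕ-fromMap = toℕ-cast (length-map facet ts)

      toℕ-toMap : ∀ k → toℕ (toMap k) ≡ toℕ k
      toℕ-toMap = toℕ-cast (sym (length-map facet ts))

      lookup-fromMap : ∀ i → facet (lookup ts (fromMap i)) ≡ lookup (map facet ts) i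
      lookup-fromMap i = sym (lookup-map facet ts i (fromMap i) (sym (toℕ-fromMap i)))

      lookup-toMap : ∀ k → facet (lookup ts k) ≡ lookup (map facet ts) (toMap k)
      lookup-toMap k = sym (lookup-map facet ts (toMap k) k (toℕ-toMap k))

      exchangeAt-map : ∀ {i j} → toℕ i < toℕ j → ExchangeAt (map facet ts) i j
      exchangeAt-map {i} {j} i<j
        with keyedExchangeAt (subst₂ _<_ (sym (toℕ-fromMap i)) (sym (toℕ-fromMap j)) i<j)
      ... | k , k<j , bridge =
        toMap k , subst₂ _<_ (sym (toℕ-toMap k)) (toℕ-fromMap j) k<j ,
        Bridge-cong (lookup-fromMap i) (lookup-fromMap j) (lookup-toMap k) bridge

    isShellingOrder-map : ∀ {Facet : Subset N → Set} →
                          (∀ F → Facet F → ∃[ t ] t ∈ₗ ts × facet t ≡ F) →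
                          (∀ {t} → t ∈ₗ ts → Facet (facet t)) →
                          IsShellingOrder Facet (map facet ts)
    isShellingOrder-map {Facet} complete sound =
      AllPairsₚ.map⁺ distinct ,
      (λ { F isFacet → let t , t∈ts , t↦F = complete F isFacet in subst (_∈ₗ _) t↦F (∈-map⁺ facet t∈ts) }) ,
      (λ { F F∈ → let t , t∈ts , F≡t = ∈-map⁻ facet F∈ in subst Facet (sym F≡t) (sound t∈ts) }) ,
      (λ j _ → intersectionFacet-card (map facet ts) exchangeAt-map j)

-- Vertex triples

private
  variable
    n : ℕ

∁-involutive : (p : Subset n) → ∁ (∁ p) ≡ p
∁-involutive p = ⊆-antisym (x∉∁p⇒x∈p ∘ x∈∁p⇒x∉p) (x∉p⇒x∈∁p ∘ x∈p⇒x∉∁p)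

∁-injective : ∀ {p q : Subset n} → ∁ p ≡ ∁ q → p ≡ q
∁-injective {p = p} {q} ∁p≡∁q = trans (sym (∁-involutive p)) (trans (cong ∁ ∁p≡∁q) (∁-involutive q))

∣⁅x⁆∪p∣≡1+∣p∣ : ∀ {x : Fin n} {p : Subset n} → x ∉ p → ∣ ⁅ x ⁆ ∪ p ∣ ≡ suc ∣ p ∣
∣⁅x⁆∪p∣≡1+∣p∣ {x = zero} {p = inside ∷ p} x∉p = ⊥-elim (x∉p here)
∣⁅x⁆∪p∣≡1+∣p∣ {x = zero} {p = outside ∷ p} x∉p = cong (suc ∘ ∣_∣) (∪-identityˡ p)
∣⁅x⁆∪p∣≡1+∣p∣ {x = suc x} {p = inside ∷ p} x∉p = cong suc (∣⁅x⁆∪p∣≡1+∣p∣ (x∉p ∘ there))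
∣⁅x⁆∪p∣≡1+∣p∣ {x = suc x} {p = outside ∷ p} x∉p = ∣⁅x⁆∪p∣≡1+∣p∣ (x∉p ∘ there)

p⊆q∧∣p∣≡∣q∣⇒p≡q : ∀ {p q : Subset n} → p ⊆ q → ∣ p ∣ ≡ ∣ q ∣ → p ≡ q
p⊆q∧∣p∣≡∣q∣⇒p≡q {p = []} {[]}          _   _ = refl
p⊆q∧∣p∣≡∣q∣⇒p≡q {p = inside  ∷ p} {inside  ∷ q} p⊆q eq =
  cong (inside ∷_) (p⊆q∧∣p∣≡∣q∣⇒p≡q (drop-∷-⊆ p⊆q) (suc-injective eq))
p⊆q∧∣p∣≡∣q∣⇒p≡q {p = outside ∷ p} {outside ∷ q} p⊆q eq =
  cong (outside ∷_) (p⊆q∧∣p∣≡∣q∣⇒p≡q (drop-∷-⊆ p⊆q) eq)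
p⊆q∧∣p∣≡∣q∣⇒p≡q {p = inside  ∷ p} {outside ∷ q} p⊆q eq with p⊆q here
... | ()
p⊆q∧∣p∣≡∣q∣⇒p≡q {p = outside ∷ p} {inside  ∷ q} p⊆q eq =
  ⊥-elim (<⇒≱ (subst (∣ q ∣ <_) (sym eq) (n<1+n ∣ q ∣)) (p⊆q⇒∣p∣≤∣q∣ (drop-∷-⊆ p⊆q)))

bridge-∁ : ∀ {n} {p q r : Subset n} {y} → y ∈ p → y ∉ q → y ∈ r →
           (∀ {x} → x ∈ r → x ∈ q ⊎ x ≡ y) → Bridge (∁ p) (∁ q) (∁ r)
bridge-∁ {n} {p} {q} {r} {y} y∈p y∉q y∈r r⊆q+y = ∁p∩∁q⊆∁r∩∁q , ∣∁r∩∁q∣≡∣∁q∣∸1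
  where
  ∉r : ∀ {x} → x ∉ q → x ≢ y → x ∉ r
  ∉r x∉q x≢y x∈r with r⊆q+y x∈r
  ... | inj₁ x∈q = x∉q x∈q
  ... | inj₂ x≡y = x≢y x≡y

  ∁p∩∁q⊆∁r∩∁q : ∁ p ∩ ∁ q ⊆ ∁ r ∩ ∁ q
  ∁p∩∁q⊆∁r∩∁q x∈ with x∈p∩q⁻ (∁ p) (∁ q) x∈
  ... | x∈∁p , x∈∁q = x∈p∩q⁺ (x∉p⇒x∈∁p (∉r (x∈∁p⇒x∉p x∈∁q) (λ { refl → x∈∁p⇒x∉p x∈∁p y∈p })) , x∈∁q)

  ∁r∩∁q≡∁[y+q] : ∁ r ∩ ∁ q ≡ ∁ (⁅ y ⁆ ∪ q)
  ∁r∩∁q≡∁[y+q] = ⊆-antisym ⊆∁[y+q] ∁[y+q]⊆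
    where
    ⊆∁[y+q] : ∁ r ∩ ∁ q ⊆ ∁ (⁅ y ⁆ ∪ q)
    ⊆∁[y+q] {x} x∈ with x∈p∩q⁻ (∁ r) (∁ q) x∈
    ... | x∈∁r , x∈∁q = x∉p⇒x∈∁p λ x∈y+q → excluded (x∈p∪q⁻ ⁅ y ⁆ q x∈y+q)
      where
      excluded : x ∈ ⁅ y ⁆ ⊎ x ∈ q → ⊥
      excluded (inj₁ x∈⁅y⁆) = x∈∁p⇒x∉p x∈∁r (subst (_∈ r) (sym (x∈⁅y⁆⇒x≡y y x∈⁅y⁆)) y∈r)
      excluded (inj₂ x∈q)   = x∈∁p⇒x∉p x∈∁q x∈q
    ∁[y+q]⊆ : ∁ (⁅ y ⁆ ∪ q) ⊆ ∁ r ∩ ∁ q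
    ∁[y+q]⊆ {x} x∈ = x∈p∩q⁺ (x∉p⇒x∈∁p (∉r x∉q x≢y) , x∉p⇒x∈∁p x∉q)
      where
      x∉q : x ∉ q
      x∉q = x∈∁p⇒x∉p x∈ ∘ x∈p∪q⁺ ∘ inj₂
      x≢y : x ≢ y
      x≢y refl = x∈∁p⇒x∉p x∈ (x∈p∪q⁺ (inj₁ (x∈⁅x⁆ y)))

  ∣∁r∩∁q∣≡∣∁q∣∸1 : ∣ ∁ r ∩ ∁ q ∣ ≡ ∣ ∁ q ∣ ∸ 1
  ∣∁r∩∁q∣≡∣∁q∣∸1 = begin
    ∣ ∁ r ∩ ∁ q ∣         ≡⟨ cong ∣_∣ ∁r∩∁q≡∁[y+q] ⟩
    ∣ ∁ (⁅ y ⁆ ∪ q) ∣     ≡⟨ ∣∁p∣≡n∸∣p∣ (⁅ y ⁆ ∪ q) ⟩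
    n ∸ ∣ ⁅ y ⁆ ∪ q ∣     ≡⟨ cong (n ∸_) (trans (∣⁅x⁆∪p∣≡1+∣p∣ y∉q) (+-comm 1 ∣ q ∣)) ⟩
    n ∸ (∣ q ∣ + 1)       ≡⟨ sym (∸-+-assoc n ∣ q ∣ 1) ⟩
    n ∸ ∣ q ∣ ∸ 1         ≡⟨ cong (_∸ 1) (sym (∣∁p∣≡n∸∣p∣ q)) ⟩
    ∣ ∁ q ∣ ∸ 1           ∎
    where open ≡-Reasoning

Triple : ℕ → Set
Triple n = Fin n × Fin n × Fin n

_∈₃_ : Fin n → Triple n → Set
x ∈₃ (a , b , c) = x ≡ a ⊎ x ≡ b ⊎ x ≡ c

pattern first  = inj₁ refl
pattern second = inj₂ (inj₁ refl)
pattern third  = inj₂ (inj₂ refl)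

support : Triple n → Subset n
support (a , b , c) = ⁅ a ⁆ ∪ ⁅ b ⁆ ∪ ⁅ c ⁆

Increasing : Triple n → Set
Increasing (a , b , c) = toℕ a < toℕ b × toℕ b < toℕ c

Distinct : Triple n → Set
Distinct (a , b , c) = a ≢ b × a ≢ c × b ≢ c

∈-support⁺ : ∀ {x} (t : Triple n) → x ∈₃ t → x ∈ support t
∈-support⁺ (a , b , c) first        = x∈p∪q⁺ (inj₁ (x∈⁅x⁆ a))
∈-support⁺ (a , b , c) second = x∈p∪q⁺ (inj₂ (x∈p∪q⁺ (inj₁ (x∈⁅x⁆ b))))
∈-support⁺ (a , b , c) third = x∈p∪q⁺ {p = ⁅ a ⁆} (inj₂ (x∈p∪q⁺ {p = ⁅ b ⁆} (inj₂ (x∈⁅x⁆ c))))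

∈-support⁻ : ∀ {x} (t : Triple n) → x ∈ support t → x ∈₃ t
∈-support⁻ (a , b , c) x∈ with x∈p∪q⁻ ⁅ a ⁆ _ x∈
... | inj₁ x∈a = inj₁ (x∈⁅y⁆⇒x≡y a x∈a)
... | inj₂ x∈bc with x∈p∪q⁻ ⁅ b ⁆ ⁅ c ⁆ x∈bc
...   | inj₁ x∈b = inj₂ (inj₁ (x∈⁅y⁆⇒x≡y b x∈b))
...   | inj₂ x∈c = inj₂ (inj₂ (x∈⁅y⁆⇒x≡y c x∈c))

increasing⇒distinct : (t : Triple n) → Increasing t → Distinct t
increasing⇒distinct t (a<b , b<c) =
  (λ { refl → <-irrefl refl a<b }) ,
  (λ { refl → <-irrefl refl (<-trans a<b b<c) }) ,
  (λ { refl → <-irrefl refl b<c })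

∣support∣≡3 : (t : Triple n) → Distinct t → ∣ support t ∣ ≡ 3
∣support∣≡3 (a , b , c) (a≢b , a≢c , b≢c) = begin
  ∣ ⁅ a ⁆ ∪ ⁅ b ⁆ ∪ ⁅ c ⁆ ∣  ≡⟨ ∣⁅x⁆∪p∣≡1+∣p∣ a∉bc ⟩
  suc ∣ ⁅ b ⁆ ∪ ⁅ c ⁆ ∣      ≡⟨ cong suc (∣⁅x⁆∪p∣≡1+∣p∣ (b≢c ∘ x∈⁅y⁆⇒x≡y c)) ⟩
  suc (suc ∣ ⁅ c ⁆ ∣)        ≡⟨ cong (2 +_) (∣⁅x⁆∣≡1 c) ⟩
  3                          ∎
  where
  open ≡-Reasoning
  a∉bc : a ∉ ⁅ b ⁆ ∪ ⁅ c ⁆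
  a∉bc a∈ with x∈p∪q⁻ ⁅ b ⁆ ⁅ c ⁆ a∈
  ... | inj₁ a∈b = a≢b (x∈⁅y⁆⇒x≡y b a∈b)
  ... | inj₂ a∈c = a≢c (x∈⁅y⁆⇒x≡y c a∈c)

module _ {a b c : Fin n} (increasing : Increasing (a , b , c)) where

  ∈₃⇒first≤ : ∀ {x} → x ∈₃ (a , b , c) → toℕ a ≤ toℕ x
  ∈₃⇒first≤ first        = ≤-refl
  ∈₃⇒first≤ second = <⇒≤ (proj₁ increasing)
  ∈₃⇒first≤ third = <⇒≤ (<-trans (proj₁ increasing) (proj₂ increasing))

  ∈₃⇒≤last : ∀ {x} → x ∈₃ (a , b , c) → toℕ x ≤ toℕ c
  ∈₃⇒≤last first        = <⇒≤ (<-trans (proj₁ increasing) (proj₂ increasing))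
  ∈₃⇒≤last second = <⇒≤ (proj₂ increasing)
  ∈₃⇒≤last third = ≤-refl

support-injective : ∀ {s t : Triple n} → Increasing s → Increasing t → support s ≡ support t → s ≡ t
support-injective {s = a′ , b′ , c′} {a , b , c} inc-s inc-t s≡t =
  cong₂ _,_ a′≡a (cong₂ _,_ b′≡b c′≡c)
  where
  s⊆t : ∀ {x} → x ∈₃ (a′ , b′ , c′) → x ∈₃ (a , b , c)
  s⊆t x∈s = ∈-support⁻ (a , b , c) (subst (_ ∈_) s≡t (∈-support⁺ (a′ , b′ , c′) x∈s))
  t⊆s : ∀ {x} → x ∈₃ (a , b , c) → x ∈₃ (a′ , b′ , c′)
  t⊆s x∈t = ∈-support⁻ (a′ , b′ , c′) (subst (_ ∈_) (sym s≡t) (∈-support⁺ (a , b , c) x∈t))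
  a′≡a : a′ ≡ a
  a′≡a = toℕ-injective (≤-antisym (∈₃⇒first≤ inc-s (t⊆s first)) (∈₃⇒first≤ inc-t (s⊆t first)))
  c′≡c : c′ ≡ c
  c′≡c = toℕ-injective (≤-antisym (∈₃⇒≤last inc-t (s⊆t third)) (∈₃⇒≤last inc-s (t⊆s third)))
  b′≡b : b′ ≡ b
  b′≡b with s⊆t second | increasing⇒distinct _ inc-s
  ... | inj₁ b′≡a        | a′≢b′ , _ , _ = ⊥-elim (a′≢b′ (trans a′≡a (sym b′≡a)))
  ... | inj₂ (inj₁ b′≡b) | _             = b′≡b
  ... | inj₂ (inj₂ b′≡c) | _ , _ , b′≢c′ = ⊥-elim (b′≢c′ (trans b′≡c (sym c′≡c)))

elements : Subset n → List (Fin n)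
elements []            = []
elements (inside  ∷ p) = zero ∷ map suc (elements p)
elements (outside ∷ p) = map suc (elements p)

length-elements : (p : Subset n) → length (elements p) ≡ ∣ p ∣
length-elements []            = refl
length-elements (inside  ∷ p) = cong suc (trans (length-map suc (elements p)) (length-elements p))
length-elements (outside ∷ p) = trans (length-map suc (elements p)) (length-elements p)

∈-elements⁺ : ∀ {x} (p : Subset n) → x ∈ p → x ∈ₗ elements p
∈-elements⁺ (inside  ∷ p) here       = Any.here refl
∈-elements⁺ (inside  ∷ p) (there x∈) = Any.there (∈-map⁺ suc (∈-elements⁺ p x∈))
∈-elements⁺ (outside ∷ p) (there x∈) = ∈-map⁺ suc (∈-elements⁺ p x∈)

∈-elements⁻ : ∀ {x} (p : Subset n) → x ∈ₗ elements p → x ∈ p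
∈-elements⁻ (inside  ∷ p) (Any.here refl) = here
∈-elements⁻ (inside  ∷ p) (Any.there x∈) with ∈-map⁻ suc x∈
... | _ , y∈ , refl = there (∈-elements⁻ p y∈)
∈-elements⁻ (outside ∷ p) x∈ with ∈-map⁻ suc x∈
... | _ , y∈ , refl = there (∈-elements⁻ p y∈)

elements-increasing : (p : Subset n) → AllPairs (λ x y → toℕ x < toℕ y) (elements p)
elements-increasing []            = []
elements-increasing (inside  ∷ p) =
  Allₚ.map⁺ (All.tabulate λ _ → s≤s z≤n) ∷ AllPairsₚ.map⁺ (AllPairs.map s≤s (elements-increasing p))
elements-increasing (outside ∷ p) = AllPairsₚ.map⁺ (AllPairs.map s≤s (elements-increasing p))

∣p∣≡3⇒support : (p : Subset n) → ∣ p ∣ ≡ 3 → ∃[ t ] Increasing t × p ≡ support t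
∣p∣≡3⇒support p ∣p∣≡3
  with elements p | trans (length-elements p) ∣p∣≡3 | elements-increasing p
     | (λ {x} → ∈-elements⁺ {x = x} p) | (λ {x} → ∈-elements⁻ {x = x} p)
... | a ∷ b ∷ c ∷ [] | _ | (a<b ∷ _) ∷ (b<c ∷ _) ∷ _ | ∈⁺ | ∈⁻ =
  (a , b , c) , (a<b , b<c) ,
  ⊆-antisym (λ x∈p → ∈-support⁺ (a , b , c) (∈ₗ⇒∈₃ (∈⁺ x∈p)))
            (λ x∈t → ∈⁻ (∈₃⇒∈ₗ (∈-support⁻ (a , b , c) x∈t)))
  where
  ∈ₗ⇒∈₃ : ∀ {x} → x ∈ₗ a ∷ b ∷ c ∷ [] → x ∈₃ (a , b , c)
  ∈ₗ⇒∈₃ (Any.here x≡a)                       = inj₁ x≡a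
  ∈ₗ⇒∈₃ (Any.there (Any.here x≡b))             = inj₂ (inj₁ x≡b)
  ∈ₗ⇒∈₃ (Any.there (Any.there (Any.here x≡c))) = inj₂ (inj₂ x≡c)
  ∈₃⇒∈ₗ : ∀ {x} → x ∈₃ (a , b , c) → x ∈ₗ a ∷ b ∷ c ∷ []
  ∈₃⇒∈ₗ (inj₁ x≡a)        = Any.here x≡a
  ∈₃⇒∈ₗ (inj₂ (inj₁ x≡b)) = Any.there (Any.here x≡b)
  ∈₃⇒∈ₗ (inj₂ (inj₂ x≡c)) = Any.there (Any.there (Any.here x≡c))
... | []                  | () | _ | _ | _
... | _ ∷ []              | () | _ | _ | _
... | _ ∷ _ ∷ []          | () | _ | _ | _
... | _ ∷ _ ∷ _ ∷ _ ∷ _   | () | _ | _ | _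

_⊆₃_ : Triple n → Triple n → Set
s ⊆₃ t = ∀ {x} → x ∈₃ s → x ∈₃ t

∈₃-swap : ∀ {x p q r : Fin n} → x ∈₃ (p , q , r) → x ∈₃ (q , p , r)
∈₃-swap first  = second
∈₃-swap second = first
∈₃-swap third  = third

_∈₃?_ : (x : Fin n) (t : Triple n) → Dec (x ∈₃ t)
x ∈₃? (a , b , c) = (x Finₚ.≟ a) ⊎-dec (x Finₚ.≟ b) ⊎-dec (x Finₚ.≟ c)

data Overlap (s t : Triple n) : Set where
  contained  : s ⊆₃ t → Overlap s t
  oneOutside : ∀ {y} → y ∈₃ s → ¬ y ∈₃ t → (∀ {x} → x ∈₃ s → x ∈₃ t ⊎ x ≡ y) → Overlap s t
  twoOutside : ∀ {y₁ y₂ z} → Distinct (y₁ , y₂ , z) → ¬ y₁ ∈₃ t → ¬ y₂ ∈₃ t →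
               (y₁ , y₂ , z) ⊆₃ s → s ⊆₃ (y₁ , y₂ , z) → Overlap s t

classify-overlap : (s t : Triple n) → Distinct s → Overlap s t
classify-overlap (p , q , r) t (p≢q , p≢r , q≢r) with p ∈₃? t | q ∈₃? t | r ∈₃? t
... | yes p∈t | yes q∈t | yes r∈t = contained λ { first → p∈t ; second → q∈t ; third → r∈t }
... | yes p∈t | yes q∈t | no  r∉t =
  oneOutside third r∉t λ { first → inj₁ p∈t ; second → inj₁ q∈t ; third → inj₂ refl }
... | yes p∈t | no  q∉t | yes r∈t =
  oneOutside second q∉t λ { first → inj₁ p∈t ; second → inj₂ refl ; third → inj₁ r∈t }
... | no  p∉t | yes q∈t | yes r∈t =
  oneOutside first p∉t λ { first → inj₂ refl ; second → inj₁ q∈t ; third → inj₁ r∈t }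
... | yes _   | no  q∉t | no  r∉t =
  twoOutside (q≢r , p≢q ∘ sym , p≢r ∘ sym) q∉t r∉t
    (λ { first → second ; second → third ; third → first })
    (λ { first → third ; second → first ; third → second })
... | no  p∉t | yes _   | no  r∉t =
  twoOutside (p≢r , p≢q , q≢r ∘ sym) p∉t r∉t
    (λ { first → first ; second → third ; third → second })
    (λ { first → first ; second → third ; third → second })
... | no  p∉t | no  q∉t | _       = twoOutside (p≢q , p≢r , q≢r) p∉t q∉t id id

support-⊆ : ∀ {s t : Triple n} → s ⊆₃ t → support s ⊆ support t
support-⊆ {s = s} {t} s⊆t = ∈-support⁺ t ∘ s⊆t ∘ ∈-support⁻ s

bridge-support : ∀ {s t u : Triple n} {y} → y ∈₃ s → ¬ y ∈₃ t → y ∈₃ u →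
                 (∀ {x} → x ∈₃ u → x ∈₃ t ⊎ x ≡ y) →
                 Bridge (∁ (support s)) (∁ (support t)) (∁ (support u))
bridge-support {s = s} {t} {u} {y} y∈s y∉t y∈u u⊆t+y =
  bridge-∁ (∈-support⁺ s y∈s) (y∉t ∘ ∈-support⁻ t) (∈-support⁺ u y∈u) u⊆t+y′
  where
  u⊆t+y′ : ∀ {x} → x ∈ support u → x ∈ support t ⊎ x ≡ y
  u⊆t+y′ x∈u with u⊆t+y (∈-support⁻ u x∈u)
  ... | inj₁ x∈t = inj₁ (∈-support⁺ t x∈t)
  ... | inj₂ x≡y = inj₂ x≡y

-- Three-vertex induced subgraphs

module InducedTriples {N : ℕ} (G : Graph N) where

  Centre : Fin N → Fin N → Fin N → Set
  Centre x p q = Adj G x p × Adj G x q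

  HasCentre : Triple N → Set
  HasCentre (a , b , c) = Centre a b c ⊎ Centre b a c ⊎ Centre c a b

  WalkIn-source∈ : ∀ {S x y} → WalkIn G S x y → x ∈ S
  WalkIn-source∈ (here x∈S)     = x∈S
  WalkIn-source∈ (step x∈S _ _) = x∈S

  isolated⇒disconnected : ∀ {S w w′} → w ∈ S → w′ ∈ S → w ≢ w′ →
                          (∀ {x} → x ∈ S → ¬ Adj G w x) → InducedDisconnected G S
  isolated⇒disconnected w∈S w′∈S w≢w′ isolated connected with connected _ _ w∈S w′∈S
  ... | here _          = w≢w′ refl
  ... | step _ w~x walk = isolated (WalkIn-source∈ walk) w~x

  module Symmetric (adj-sym : ∀ {x y} → Adj G x y → Adj G y x) where

    walkFromCentre : ∀ {S w y} → w ∈ S → y ∈ S → y ≡ w ⊎ Adj G w y → WalkIn G S w y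
    walkFromCentre w∈S y∈S (inj₁ refl) = here w∈S
    walkFromCentre w∈S y∈S (inj₂ w~y)  = step w∈S w~y (here y∈S)

    star⇒connected : ∀ {S w} → w ∈ S → (∀ {x} → x ∈ S → x ≡ w ⊎ Adj G w x) → InducedConnected G S
    star⇒connected w∈S near x y x∈S y∈S with near x∈S
    ... | inj₁ refl = walkFromCentre w∈S y∈S (near y∈S)
    ... | inj₂ w~x  = step x∈S (adj-sym w~x) (walkFromCentre w∈S y∈S (near y∈S))

    hasCentre⇒connected : (t : Triple N) → HasCentre t → InducedConnected G (support t)
    hasCentre⇒connected t@(a , b , c) (inj₁ (a~b , a~c)) =
      star⇒connected (∈-support⁺ t first) λ x∈ → near (∈-support⁻ t x∈)
      where
      near : ∀ {x} → x ∈₃ t → x ≡ a ⊎ Adj G a x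
      near first        = inj₁ refl
      near second = inj₂ a~b
      near third = inj₂ a~c
    hasCentre⇒connected t@(a , b , c) (inj₂ (inj₁ (b~a , b~c))) =
      star⇒connected (∈-support⁺ t second) λ x∈ → near (∈-support⁻ t x∈)
      where
      near : ∀ {x} → x ∈₃ t → x ≡ b ⊎ Adj G b x
      near first        = inj₂ b~a
      near second = inj₁ refl
      near third = inj₂ b~c
    hasCentre⇒connected t@(a , b , c) (inj₂ (inj₂ (c~a , c~b))) =
      star⇒connected (∈-support⁺ t third) λ x∈ → near (∈-support⁻ t x∈)
      where
      near : ∀ {x} → x ∈₃ t → x ≡ c ⊎ Adj G c x
      near first        = inj₂ c~a
      near second = inj₂ c~b
      near third = inj₁ refl

    hasCentre-rotate : ∀ {a b c} → HasCentre (a , b , c) → HasCentre (b , c , a)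
    hasCentre-rotate (inj₁ (a~b , a~c))        = inj₂ (inj₂ (a~b , a~c))
    hasCentre-rotate (inj₂ (inj₁ (b~a , b~c))) = inj₁ (b~c , b~a)
    hasCentre-rotate (inj₂ (inj₂ (c~a , c~b))) = inj₂ (inj₁ (c~b , c~a))

    hasCentre-swap : ∀ {a b c} → HasCentre (a , b , c) → HasCentre (a , c , b)
    hasCentre-swap (inj₁ (a~b , a~c))        = inj₁ (a~c , a~b)
    hasCentre-swap (inj₂ (inj₁ (b~a , b~c))) = inj₂ (inj₂ (b~a , b~c))
    hasCentre-swap (inj₂ (inj₂ (c~a , c~b))) = inj₂ (inj₁ (c~a , c~b))

    first-isolated : ∀ {a b c} → ¬ Adj G a b → ¬ Adj G a c → ¬ HasCentre (a , b , c)
    first-isolated a≁b a≁c (inj₁ (a~b , _))        = a≁b a~b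
    first-isolated a≁b a≁c (inj₂ (inj₁ (b~a , _))) = a≁b (adj-sym b~a)
    first-isolated a≁b a≁c (inj₂ (inj₂ (c~a , _))) = a≁c (adj-sym c~a)

    second-isolated : ∀ {a b c} → ¬ Adj G b a → ¬ Adj G b c → ¬ HasCentre (a , b , c)
    second-isolated b≁a b≁c = first-isolated b≁c b≁a ∘ hasCentre-rotate

    third-isolated : ∀ {a b c} → ¬ Adj G c a → ¬ Adj G c b → ¬ HasCentre (a , b , c)
    third-isolated c≁a c≁b = first-isolated c≁a c≁b ∘ hasCentre-rotate ∘ hasCentre-rotate

    module Decidable (adj-irrefl : ∀ {x} → ¬ Adj G x x) (adj? : ∀ x y → Dec (Adj G x y)) where

      private
        isolatedIn : ∀ {w} (t : Triple N) → (∀ {x} → x ∈₃ t → x ≢ w → ¬ Adj G w x) →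
                     ∀ {x} → x ∈ support t → ¬ Adj G w x
        isolatedIn t isolated x∈ w~x = isolated (∈-support⁻ t x∈) (λ { refl → adj-irrefl w~x }) w~x

      ¬hasCentre⇒disconnected : (t : Triple N) → Distinct t → ¬ HasCentre t →
                                InducedDisconnected G (support t)
      ¬hasCentre⇒disconnected t@(a , b , c) (a≢b , a≢c , b≢c) noCentre
        with adj? a b | adj? a c | adj? b c
      ... | yes a~b | yes a~c | _       = λ _ → noCentre (inj₁ (a~b , a~c))
      ... | yes a~b | no _    | yes b~c = λ _ → noCentre (inj₂ (inj₁ (adj-sym a~b , b~c)))
      ... | no _    | yes a~c | yes b~c = λ _ → noCentre (inj₂ (inj₂ (adj-sym a~c , adj-sym b~c)))
      ... | yes _   | no a≁c  | no b≁c  =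
        isolated⇒disconnected
          (∈-support⁺ t third) (∈-support⁺ t first) (a≢c ∘ sym) (isolatedIn t isolated)
        where
        isolated : ∀ {x} → x ∈₃ t → x ≢ c → ¬ Adj G c x
        isolated first        _   = a≁c ∘ adj-sym
        isolated second _   = b≁c ∘ adj-sym
        isolated third x≢c = ⊥-elim (x≢c refl)
      ... | no a≁b  | yes _   | no b≁c  =
        isolated⇒disconnected
          (∈-support⁺ t second) (∈-support⁺ t first) (a≢b ∘ sym) (isolatedIn t isolated)
        where
        isolated : ∀ {x} → x ∈₃ t → x ≢ b → ¬ Adj G b x
        isolated first        _   = a≁b ∘ adj-sym
        isolated second x≢b = ⊥-elim (x≢b refl)
        isolated third _   = b≁c
      ... | no a≁b  | no a≁c  | _       =
        isolated⇒disconnected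
          (∈-support⁺ t first) (∈-support⁺ t second) a≢b (isolatedIn t isolated)
        where
        isolated : ∀ {x} → x ∈₃ t → x ≢ a → ¬ Adj G a x
        isolated first        x≢a = ⊥-elim (x≢a refl)
        isolated second _   = a≁b
        isolated third _   = a≁c

      hasCentre? : ∀ t → Dec (HasCentre t)
      hasCentre? (a , b , c) =
        (adj? a b ×-dec adj? a c) ⊎-dec (adj? b a ×-dec adj? b c) ⊎-dec (adj? c a ×-dec adj? c b)

-- Grid graphs

positional-< : ∀ base {q q′ r r′} → r < base → q < q′ → base * q + r < base * q′ + r′
positional-< base {q} {q′} {r} {r′} r<base q<q′ = begin-strict
  base * q + r       <⟨ +-monoʳ-< (base * q) r<base ⟩
  base * q + base    ≡⟨ +-comm (base * q) base ⟩
  base + base * q    ≡⟨ *-suc base q ⟨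
  base * suc q       ≤⟨ *-monoʳ-≤ base q<q′ ⟩
  base * q′          ≤⟨ m≤m+n (base * q′) r′ ⟩
  base * q′ + r′     ∎
  where open ≤-Reasoning

positional-≤⇒≤ : ∀ base {q q′ r r′} → r′ < base → base * q + r ≤ base * q′ + r′ → q ≤ q′
positional-≤⇒≤ base {q} {q′} r′<base ≤ with q ≤? q′
... | yes q≤q′ = q≤q′
... | no  q≰q′ = ⊥-elim (<⇒≱ (positional-< base r′<base (≰⇒> q≰q′)) ≤)

parity-suc : ∀ k → parity (suc k) ≡ parity k ⁻¹
parity-suc k = sym (⁻¹-selfInverse (suc-homo-⁻¹ k))

module Grid (m n : ℕ) where

  G : Graph (m * n)
  G = gridGraph m n

  Vertex : Set
  Vertex = Fin (m * n)

  row col : Vertex → ℕ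
  row x = toℕ (proj₁ (remQuot {m} n x))
  col x = toℕ (proj₂ (remQuot {m} n x))

  toℕ≡n*row+col : ∀ x → toℕ x ≡ n * row x + col x
  toℕ≡n*row+col x = trans (cong toℕ (sym (combine-remQuot {m} n x)))
                          (toℕ-combine (proj₁ (remQuot {m} n x)) (proj₂ (remQuot {m} n x)))

  row<m : ∀ x → row x < m
  row<m x = toℕ<n (proj₁ (remQuot {m} n x))

  col<n : ∀ x → col x < n
  col<n x = toℕ<n (proj₂ (remQuot {m} n x))

  coordinates-injective : ∀ {x y} → row x ≡ row y → col x ≡ col y → x ≡ y
  coordinates-injective {x} {y} rx≡ry cx≡cy = begin
    x                                  ≡⟨ combine-remQuot {m} n x ⟨
    uncurry combine (remQuot {m} n x)  ≡⟨ cong₂ combine (toℕ-injective rx≡ry) (toℕ-injective cx≡cy) ⟩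
    uncurry combine (remQuot {m} n y)  ≡⟨ combine-remQuot {m} n y ⟩
    y                                  ∎
    where open ≡-Reasoning

  <⇒row≤ : ∀ {x y} → toℕ x < toℕ y → row x ≤ row y
  <⇒row≤ {x} {y} x<y =
    positional-≤⇒≤ n (col<n y) (subst₂ _≤_ (toℕ≡n*row+col x) (toℕ≡n*row+col y) (<⇒≤ x<y))

  sameRow-col<⇒< : ∀ {x y} → row x ≡ row y → col x < col y → toℕ x < toℕ y
  sameRow-col<⇒< {x} {y} rx≡ry cx<cy rewrite toℕ≡n*row+col x | toℕ≡n*row+col y | rx≡ry =
    +-monoʳ-< (n * row y) cx<cy

  Down Right : Vertex → Vertex → Set
  Down  x y = suc (row x) ≡ row y × col x ≡ col y
  Right x y = row x ≡ row y × suc (col x) ≡ col y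

  data Step (x y : Vertex) : Set where
    down  : Down x y  → Step x y
    up    : Down y x  → Step x y
    right : Right x y → Step x y
    left  : Right y x → Step x y

  adj⇒step : ∀ {x y} → Adj G x y → Step x y
  adj⇒step (inj₁ (inj₁ rx+1≡ry , cx≡cy)) = down (rx+1≡ry , cong toℕ cx≡cy)
  adj⇒step (inj₁ (inj₂ ry+1≡rx , cx≡cy)) = up (ry+1≡rx , cong toℕ (sym cx≡cy))
  adj⇒step (inj₂ (rx≡ry , inj₁ cx+1≡cy)) = right (cong toℕ rx≡ry , cx+1≡cy)
  adj⇒step (inj₂ (rx≡ry , inj₂ cy+1≡cx)) = left (cong toℕ (sym rx≡ry) , cy+1≡cx)

  step⇒adj : ∀ {x y} → Step x y → Adj G x y
  step⇒adj (down  (rx+1≡ry , cx≡cy)) = inj₁ (inj₁ rx+1≡ry , toℕ-injective cx≡cy)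
  step⇒adj (up    (ry+1≡rx , cy≡cx)) = inj₁ (inj₂ ry+1≡rx , toℕ-injective (sym cy≡cx))
  step⇒adj (right (rx≡ry , cx+1≡cy)) = inj₂ (toℕ-injective rx≡ry , inj₁ cx+1≡cy)
  step⇒adj (left  (ry≡rx , cy+1≡cx)) = inj₂ (toℕ-injective (sym ry≡rx) , inj₂ cy+1≡cx)

  adj-sym : ∀ {x y} → Adj G x y → Adj G y x
  adj-sym (inj₁ (vertical , cx≡cy))   = inj₁ (Sum.swap vertical , sym cx≡cy)
  adj-sym (inj₂ (rx≡ry , horizontal)) = inj₂ (sym rx≡ry , Sum.swap horizontal)

  adj-irrefl : ∀ {x} → ¬ Adj G x x
  adj-irrefl x~x with adj⇒step x~x
  ... | down  (r+1≡r , _) = 1+n≢n r+1≡r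
  ... | up    (r+1≡r , _) = 1+n≢n r+1≡r
  ... | right (_ , c+1≡c) = 1+n≢n c+1≡c
  ... | left  (_ , c+1≡c) = 1+n≢n c+1≡c

  adj? : ∀ x y → Dec (Adj G x y)
  adj? x y =
    (((suc (row x) ≟ row y) ⊎-dec (suc (row y) ≟ row x)) ×-dec (cx Finₚ.≟ cy))
    ⊎-dec ((rx Finₚ.≟ ry) ×-dec ((suc (col x) ≟ col y) ⊎-dec (suc (col y) ≟ col x)))
    where
    rx ry : Fin m
    rx = proj₁ (remQuot {m} n x)
    ry = proj₁ (remQuot {m} n y)
    cx cy : Fin n
    cx = proj₂ (remQuot {m} n x)
    cy = proj₂ (remQuot {m} n y)

  colour : Vertex → Parity
  colour x = parity (row x + col x)

  colour-step : ∀ {x y} → Step x y → colour y ≡ colour x ⁻¹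
  colour-step {x} {y} (down (rx+1≡ry , cx≡cy)) = begin
    parity (row y + col y)        ≡⟨ cong parity (cong₂ _+_ (sym rx+1≡ry) (sym cx≡cy)) ⟩
    parity (suc (row x + col x))  ≡⟨ parity-suc (row x + col x) ⟩
    colour x ⁻¹                   ∎
    where open ≡-Reasoning
  colour-step (up y↓x)     = sym (⁻¹-selfInverse (sym (colour-step (down y↓x))))
  colour-step {x} {y} (right (rx≡ry , cx+1≡cy)) = begin
    parity (row y + col y)        ≡⟨ cong parity (cong₂ _+_ (sym rx≡ry) (sym cx+1≡cy)) ⟩
    parity (row x + suc (col x))  ≡⟨ cong parity (+-suc (row x) (col x)) ⟩
    parity (suc (row x + col x))  ≡⟨ parity-suc (row x + col x) ⟩
    colour x ⁻¹                   ∎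
    where open ≡-Reasoning
  colour-step (left y→x)   = sym (⁻¹-selfInverse (sym (colour-step (right y→x))))

  triangle-free : ∀ {x y z} → Adj G x y → Adj G y z → Adj G x z → ⊥
  triangle-free {x} {y} {z} x~y y~z x~z = p≢p⁻¹ (colour x) (begin
    colour x          ≡⟨ ⁻¹-involutive (colour x) ⟨
    colour x ⁻¹ ⁻¹    ≡⟨ cong _⁻¹ (colour-step (adj⇒step x~y)) ⟨
    colour y ⁻¹       ≡⟨ colour-step (adj⇒step y~z) ⟨
    colour z          ≡⟨ colour-step (adj⇒step x~z) ⟩
    colour x ⁻¹       ∎)
    where open ≡-Reasoning

  open InducedTriples G
  open Symmetric adj-sym
  open Decidable adj-irrefl adj?

  Down-unique : ∀ {x y y′} → Down x y → Down x y′ → y ≡ y′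
  Down-unique (rx+1≡ry , cx≡cy) (rx+1≡ry′ , cx≡cy′) =
    coordinates-injective (trans (sym rx+1≡ry) rx+1≡ry′) (trans (sym cx≡cy) cx≡cy′)

  Down-unique˘ : ∀ {x x′ y} → Down x y → Down x′ y → x ≡ x′
  Down-unique˘ (rx+1≡ry , cx≡cy) (rx′+1≡ry , cx′≡cy) =
    coordinates-injective (suc-injective (trans rx+1≡ry (sym rx′+1≡ry))) (trans cx≡cy (sym cx′≡cy))

  Right-unique : ∀ {x y y′} → Right x y → Right x y′ → y ≡ y′
  Right-unique (rx≡ry , cx+1≡cy) (rx≡ry′ , cx+1≡cy′) =
    coordinates-injective (trans (sym rx≡ry) rx≡ry′) (trans (sym cx+1≡cy) cx+1≡cy′)

  Right-unique˘ : ∀ {x x′ y} → Right x y → Right x′ y → x ≡ x′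
  Right-unique˘ (rx≡ry , cx+1≡cy) (rx′≡ry , cx′+1≡cy) =
    coordinates-injective (trans rx≡ry (sym rx′≡ry)) (suc-injective (trans cx+1≡cy (sym cx′+1≡cy)))

  belowRight : ∀ {a b p q} → Down a p → Down b q → Right a b → Right p q
  belowRight (ra+1≡rp , ca≡cp) (rb+1≡rq , cb≡cq) (ra≡rb , ca+1≡cb) =
    trans (sym ra+1≡rp) (trans (cong suc ra≡rb) rb+1≡rq) ,
    trans (cong suc (sym ca≡cp)) (trans ca+1≡cb cb≡cq)

  adj∧row<⇒Down : ∀ {x y} → Adj G x y → row x < row y → Down x y
  adj∧row<⇒Down x~y rx<ry with adj⇒step x~y
  ... | down  x↓y              = x↓y
  ... | up    (ry+1≡rx , _)    = ⊥-elim (<-asym rx<ry (≤-reflexive ry+1≡rx))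
  ... | right (rx≡ry , _)      = ⊥-elim (<-irrefl rx≡ry rx<ry)
  ... | left  (ry≡rx , _)      = ⊥-elim (<-irrefl (sym ry≡rx) rx<ry)

  adj∧sameRow⇒Right : ∀ {x y} → Adj G x y → toℕ x < toℕ y → row x ≡ row y → Right x y
  adj∧sameRow⇒Right x~y x<y rx≡ry with adj⇒step x~y
  ... | down  (rx+1≡ry , _) = ⊥-elim (1+n≢n (trans rx+1≡ry (sym rx≡ry)))
  ... | up    (ry+1≡rx , _) = ⊥-elim (1+n≢n (trans ry+1≡rx rx≡ry))
  ... | right x→y           = x→y
  ... | left  (ry≡rx , cy+1≡cx) =
    ⊥-elim (<-asym x<y (sameRow-col<⇒< ry≡rx (≤-reflexive cy+1≡cx)))

  CutTriple : Triple (m * n) → Set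
  CutTriple t = Increasing t × InducedDisconnected G (support t)

  adjacencyBit : Vertex → Vertex → ℕ
  adjacencyBit x y with adj? x y
  ... | yes _ = 1
  ... | no  _ = 0

  adjacencyBit-yes : ∀ {x y} → Adj G x y → adjacencyBit x y ≡ 1
  adjacencyBit-yes {x} {y} x~y with adj? x y
  ... | yes _   = refl
  ... | no  x≁y = ⊥-elim (x≁y x~y)

  adjacencyBit-no : ∀ {x y} → ¬ Adj G x y → adjacencyBit x y ≡ 0
  adjacencyBit-no {x} {y} x≁y with adj? x y
  ... | yes x~y = ⊥-elim (x≁y x~y)
  ... | no  _   = refl

  adjacencyBit≤1 : ∀ x y → adjacencyBit x y ≤ 1
  adjacencyBit≤1 x y with adj? x y
  ... | yes _ = s≤s z≤n
  ... | no  _ = z≤n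

  rank : Vertex → Vertex → ℕ
  rank a b = 2 * row b + adjacencyBit a b

  -- Lexicographic in (c, row b, [a ~ b]), packed into one number since rank a b < 2 * m.
  key : Triple (m * n) → ℕ
  key (a , b , c) = 2 * m * toℕ c + rank a b

  rank<2*[1+row] : ∀ a b → rank a b < 2 * suc (row b)
  rank<2*[1+row] a b = begin-strict
    2 * row b + adjacencyBit a b  ≤⟨ +-monoʳ-≤ (2 * row b) (adjacencyBit≤1 a b) ⟩
    2 * row b + 1                 <⟨ +-monoʳ-< (2 * row b) (n<1+n 1) ⟩
    2 * row b + 2                 ≡⟨ +-comm (2 * row b) 2 ⟩
    2 + 2 * row b                 ≡⟨ *-suc 2 (row b) ⟨
    2 * suc (row b)               ∎
    where open ≤-Reasoning

  rank<2m : ∀ a b → rank a b < 2 * m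
  rank<2m a b = ≤-trans (rank<2*[1+row] a b) (*-monoʳ-≤ 2 (row<m b))

  key<-byTop : ∀ {a′ b′ c′ a b c} → toℕ c′ < toℕ c → key (a′ , b′ , c′) < key (a , b , c)
  key<-byTop {a′} {b′} c′<c = positional-< (2 * m) (rank<2m a′ b′) c′<c

  key≤⇒top≤ : ∀ {a′ b′ c′ a b c} → key (a′ , b′ , c′) ≤ key (a , b , c) → toℕ c′ ≤ toℕ c
  key≤⇒top≤ {a = a} {b} = positional-≤⇒≤ (2 * m) (rank<2m a b)

  key<-byRank : ∀ {a′ b′ a b c} → rank a′ b′ < rank a b → key (a′ , b′ , c) < key (a , b , c)
  key<-byRank {c = c} = +-monoʳ-< (2 * m * toℕ c)

  rank<-byRow : ∀ {a′ b′ a b} → row b′ < row b → rank a′ b′ < rank a b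
  rank<-byRow {a′} {b′} {a} {b} rb′<rb = begin-strict
    rank a′ b′                       <⟨ rank<2*[1+row] a′ b′ ⟩
    2 * suc (row b′)                 ≤⟨ *-monoʳ-≤ 2 rb′<rb ⟩
    2 * row b                        ≤⟨ m≤m+n (2 * row b) (adjacencyBit a b) ⟩
    2 * row b + adjacencyBit a b     ∎
    where open ≤-Reasoning

  rank<-byAdjacency : ∀ {a′ b′ a b} → row b′ ≤ row b → ¬ Adj G a′ b′ → Adj G a b →
                      rank a′ b′ < rank a b
  rank<-byAdjacency {a′} {b′} {a} {b} rb′≤rb a′≁b′ a~b = begin-strict
    2 * row b′ + adjacencyBit a′ b′  ≡⟨ cong (2 * row b′ +_) (adjacencyBit-no a′≁b′) ⟩
    2 * row b′ + 0                   ≤⟨ +-monoˡ-≤ 0 (*-monoʳ-≤ 2 rb′≤rb) ⟩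
    2 * row b + 0                    <⟨ +-monoʳ-< (2 * row b) (s≤s z≤n) ⟩
    2 * row b + 1                    ≡⟨ cong (2 * row b +_) (adjacencyBit-yes a~b) ⟨
    2 * row b + adjacencyBit a b     ∎
    where open ≤-Reasoning

  data CommonNeighbour (a b y : Vertex) : ℕ → Set where
    vertical   : Down a y  → CommonNeighbour a b y 2
    horizontal : Right a y → CommonNeighbour a b y 0
    upper      : Down y b  → CommonNeighbour a b y 1
    lower      : Down a y  → CommonNeighbour a b y 1

  commonNeighbour : ∀ {a b y} → toℕ a < toℕ b → Adj G y a → Adj G y b →
                    ∃[ gap ] CommonNeighbour a b y gap × row b ≡ gap + row a
  commonNeighbour {a} {b} {y} a<b y~a y~b = classify (adj⇒step y~a) (adj⇒step y~b)
    where
    a≢b : a ≢ b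
    a≢b refl = <-irrefl refl a<b
    rb≮ra : ¬ row b < row a
    rb≮ra rb<ra = <⇒≱ rb<ra (<⇒row≤ a<b)
    classify : Step y a → Step y b → ∃[ gap ] CommonNeighbour a b y gap × row b ≡ gap + row a
    classify (down y↓a) (down y↓b) = ⊥-elim (a≢b (Down-unique y↓a y↓b))
    classify (down (ry+1≡ra , _)) (up (rb+1≡ry , _)) =
      ⊥-elim (rb≮ra (≤-trans (n≤1+n _) (≤-reflexive (trans (cong suc rb+1≡ry) ry+1≡ra))))
    classify (down (ry+1≡ra , _)) (right (ry≡rb , _)) =
      ⊥-elim (rb≮ra (≤-reflexive (trans (cong suc (sym ry≡rb)) ry+1≡ra)))
    classify (down (ry+1≡ra , _)) (left (rb≡ry , _)) =
      ⊥-elim (rb≮ra (≤-reflexive (trans (cong suc rb≡ry) ry+1≡ra)))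
    classify (up a↓y@(ra+1≡ry , _)) (down (ry+1≡rb , _)) =
      2 , vertical a↓y , sym (trans (cong suc ra+1≡ry) ry+1≡rb)
    classify (up a↓y) (up b↓y) = ⊥-elim (a≢b (Down-unique˘ a↓y b↓y))
    classify (up a↓y@(ra+1≡ry , _)) (right (ry≡rb , _)) = 1 , lower a↓y , sym (trans ra+1≡ry ry≡rb)
    classify (up a↓y@(ra+1≡ry , _)) (left (rb≡ry , _))  = 1 , lower a↓y , sym (trans ra+1≡ry (sym rb≡ry))
    classify (right (ry≡ra , _)) (down y↓b@(ry+1≡rb , _)) =
      1 , upper y↓b , sym (trans (cong suc (sym ry≡ra)) ry+1≡rb)
    classify (right (ry≡ra , _)) (up (rb+1≡ry , _)) = ⊥-elim (rb≮ra (≤-reflexive (trans rb+1≡ry ry≡ra)))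
    classify (right y→a) (right y→b) = ⊥-elim (a≢b (Right-unique y→a y→b))
    classify (right (ry≡ra , cy+1≡ca)) (left (rb≡ry , cb+1≡cy)) =
      ⊥-elim (<-asym a<b (sameRow-col<⇒< (trans rb≡ry ry≡ra)
                                          (<-trans (≤-reflexive cb+1≡cy) (≤-reflexive cy+1≡ca))))
    classify (left (ra≡ry , _)) (down y↓b@(ry+1≡rb , _)) =
      1 , upper y↓b , sym (trans (cong suc ra≡ry) ry+1≡rb)
    classify (left (ra≡ry , _)) (up (rb+1≡ry , _)) = ⊥-elim (rb≮ra (≤-reflexive (trans rb+1≡ry (sym ra≡ry))))
    classify (left a→y@(ra≡ry , _)) (right (ry≡rb , _)) = 0 , horizontal a→y , sym (trans ra≡ry ry≡rb)
    classify (left a→y) (left b→y) = ⊥-elim (a≢b (Right-unique˘ a→y b→y))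

  -- The exchange property

  module Exchange {a b c : Vertex} (t-cut : CutTriple (a , b , c)) where

    t : Triple (m * n)
    t = a , b , c

    a<b : toℕ a < toℕ b
    a<b = proj₁ (proj₁ t-cut)

    b<c : toℕ b < toℕ c
    b<c = proj₂ (proj₁ t-cut)

    t-noCentre : ¬ HasCentre t
    t-noCentre = proj₂ t-cut ∘ hasCentre⇒connected t

    Improvement : Vertex → Set
    Improvement y = ∃[ u ] CutTriple u × y ∈₃ u × (∀ {x} → x ∈₃ u → x ∈₃ t ⊎ x ≡ y) × key u < key t

    improvement : ∀ {y} p q r → Increasing (p , q , r) → ¬ HasCentre (p , q , r) → y ∈₃ (p , q , r) →
                  (p ∈₃ t ⊎ p ≡ y) × (q ∈₃ t ⊎ q ≡ y) × (r ∈₃ t ⊎ r ≡ y) →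
                  key (p , q , r) < key t → Improvement y
    improvement {y} p q r increasing noCentre y∈u (p∈ , q∈ , r∈) u<t =
      (p , q , r) ,
      (increasing , ¬hasCentre⇒disconnected (p , q , r) (increasing⇒distinct (p , q , r) increasing) noCentre) ,
      y∈u , covered , u<t
      where
      covered : ∀ {x} → x ∈₃ (p , q , r) → x ∈₃ t ⊎ x ≡ y
      covered first  = p∈
      covered second = q∈
      covered third  = r∈

    module _ {y} (y∉t : ¬ y ∈₃ t) (y<c : toℕ y < toℕ c) where

      replaceTop : Improvement y ⊎ HasCentre (a , b , y)
      replaceTop with <-cmp (toℕ y) (toℕ a) | <-cmp (toℕ y) (toℕ b)
      ... | tri≈ _ y≡a _ | _ = ⊥-elim (y∉t (inj₁ (toℕ-injective y≡a)))
      ... | _ | tri≈ _ y≡b _ = ⊥-elim (y∉t (inj₂ (inj₁ (toℕ-injective y≡b))))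
      ... | tri< y<a _ _ | _ with hasCentre? (y , a , b)
      ...   | yes centre   = inj₂ (hasCentre-rotate centre)
      ...   | no  noCentre = inj₁ (improvement y a b (y<a , a<b) noCentre first
                                     (inj₂ refl , inj₁ first , inj₁ second) (key<-byTop b<c))
      replaceTop | tri> _ _ a<y | tri< y<b _ _ with hasCentre? (a , y , b)
      ...   | yes centre   = inj₂ (hasCentre-swap centre)
      ...   | no  noCentre = inj₁ (improvement a y b (a<y , y<b) noCentre second
                                     (inj₁ first , inj₂ refl , inj₁ second) (key<-byTop b<c))
      replaceTop | tri> _ _ a<y | tri> _ _ b<y with hasCentre? (a , b , y)
      ...   | yes centre   = inj₂ centre
      ...   | no  noCentre = inj₁ (improvement a b y (a<b , b<y) noCentre third
                                     (inj₁ first , inj₁ second , inj₂ refl) (key<-byTop y<c))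

    module Adjacent (a~b : Adj G a b) where

      c≁a : ¬ Adj G c a
      c≁a c~a = t-noCentre (inj₁ (a~b , adj-sym c~a))

      c≁b : ¬ Adj G c b
      c≁b c~b = t-noCentre (inj₂ (inj₁ (adj-sym a~b , adj-sym c~b)))

      y~a⇒y≁b : ∀ {y} → Adj G y a → ¬ Adj G y b
      y~a⇒y≁b y~a = triangle-free y~a a~b

      y~b⇒y≁a : ∀ {y} → Adj G y b → ¬ Adj G y a
      y~b⇒y≁a y~b = triangle-free y~b (adj-sym a~b)

      Blocked : Vertex → Set
      Blocked y = Down b y ⊎ (Down a y × Right a b)

      module _ {y} (y∉t : ¬ y ∈₃ t) (y<c : toℕ y < toℕ c) where

        replaceFirst : Adj G y a → Improvement y ⊎ Blocked y
        replaceFirst y~a with <-cmp (toℕ y) (toℕ b)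
        ... | tri≈ _ y≡b _ = ⊥-elim (y∉t (inj₂ (inj₁ (toℕ-injective y≡b))))
        ... | tri< y<b _ _ =
          inj₁ (improvement y b c (y<b , b<c) (second-isolated (y~a⇒y≁b y~a ∘ adj-sym) (c≁b ∘ adj-sym)) first
                  (inj₂ refl , inj₁ second , inj₁ third)
                  (key<-byRank (rank<-byAdjacency ≤-refl (y~a⇒y≁b y~a) a~b)))
        ... | tri> _ _ b<y with row y ≤? row b
        ...   | yes ry≤rb =
          inj₁ (improvement b y c (b<y , y<c) (first-isolated (y~a⇒y≁b y~a ∘ adj-sym) (c≁b ∘ adj-sym)) second
                  (inj₁ second , inj₂ refl , inj₁ third)
                  (key<-byRank (rank<-byAdjacency ry≤rb (y~a⇒y≁b y~a ∘ adj-sym) a~b)))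
        ...   | no ry≰rb = inj₂ (inj₂ (a↓y , adj∧sameRow⇒Right a~b a<b ra≡rb))
          where
          rb<ry : row b < row y
          rb<ry = ≰⇒> ry≰rb
          a↓y : Down a y
          a↓y = adj∧row<⇒Down (adj-sym y~a) (≤-<-trans (<⇒row≤ a<b) rb<ry)
          ra≡rb : row a ≡ row b
          ra≡rb = ≤-antisym (<⇒row≤ a<b) (m<1+n⇒m≤n (subst (row b <_) (sym (proj₁ a↓y)) rb<ry))

        replaceSecond : Adj G y b → Improvement y ⊎ Blocked y
        replaceSecond y~b with <-cmp (toℕ y) (toℕ a)
        ... | tri≈ _ y≡a _ = ⊥-elim (y∉t (inj₁ (toℕ-injective y≡a)))
        ... | tri< y<a _ _ =
          inj₁ (improvement y a c (y<a , <-trans a<b b<c)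
                  (second-isolated (y~b⇒y≁a y~b ∘ adj-sym) (c≁a ∘ adj-sym)) first
                  (inj₂ refl , inj₁ first , inj₁ third)
                  (key<-byRank (rank<-byAdjacency (<⇒row≤ a<b) (y~b⇒y≁a y~b) a~b)))
        ... | tri> _ _ a<y with row y ≤? row b
        ...   | yes ry≤rb =
          inj₁ (improvement a y c (a<y , y<c) (first-isolated (y~b⇒y≁a y~b ∘ adj-sym) (c≁a ∘ adj-sym)) second
                  (inj₁ first , inj₂ refl , inj₁ third)
                  (key<-byRank (rank<-byAdjacency ry≤rb (y~b⇒y≁a y~b ∘ adj-sym) a~b)))
        ...   | no ry≰rb = inj₂ (inj₁ (adj∧row<⇒Down (adj-sym y~b) (≰⇒> ry≰rb)))

        improveOrBlocked : Improvement y ⊎ Blocked y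
        improveOrBlocked with replaceTop y∉t y<c
        ... | inj₁ better                    = inj₁ better
        ... | inj₂ (inj₁ (_ , a~y))          = replaceFirst (adj-sym a~y)
        ... | inj₂ (inj₂ (inj₁ (_ , b~y)))   = replaceSecond (adj-sym b~y)
        ... | inj₂ (inj₂ (inj₂ (y~a , y~b))) = ⊥-elim (triangle-free y~a a~b y~b)

    module Nonadjacent (a≁b : ¬ Adj G a b) where

      Blocked : Vertex → Set
      Blocked y = Centre y a b × (Adj G c a ⊎ Adj G c y ⊎ row b ≤ row a ⊎ row b ≤ row y)

      improveOrBlocked : ∀ {y} → ¬ y ∈₃ t → toℕ y < toℕ c → Improvement y ⊎ Blocked y
      improveOrBlocked {y} y∉t y<c with replaceTop y∉t y<c
      ... | inj₁ better                  = inj₁ better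
      ... | inj₂ (inj₁ (a~b , _))        = ⊥-elim (a≁b a~b)
      ... | inj₂ (inj₂ (inj₁ (b~a , _))) = ⊥-elim (a≁b (adj-sym b~a))
      ... | inj₂ (inj₂ (inj₂ centre)) with adj? c a | adj? c y
      ...   | yes c~a | _       = inj₂ (centre , inj₁ c~a)
      ...   | no _    | yes c~y = inj₂ (centre , inj₂ (inj₁ c~y))
      ...   | no c≁a  | no c≁y with <-cmp (toℕ y) (toℕ a)
      ...     | tri≈ _ y≡a _ = ⊥-elim (y∉t (inj₁ (toℕ-injective y≡a)))
      ...     | tri< y<a _ _ with row a <? row b
      ...       | yes ra<rb = inj₁ (improvement y a c (y<a , <-trans a<b b<c) (third-isolated c≁y c≁a) first
                                      (inj₂ refl , inj₁ first , inj₁ third) (key<-byRank (rank<-byRow ra<rb)))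
      ...       | no  ra≮rb = inj₂ (centre , inj₂ (inj₂ (inj₁ (≮⇒≥ ra≮rb))))
      improveOrBlocked {y} y∉t y<c | inj₂ (inj₂ (inj₂ centre)) | no c≁a | no c≁y | tri> _ _ a<y
        with row y <? row b
      ...       | yes ry<rb = inj₁ (improvement a y c (a<y , y<c) (third-isolated c≁a c≁y) second
                                      (inj₁ first , inj₂ refl , inj₁ third) (key<-byRank (rank<-byRow ry<rb)))
      ...       | no  ry≮rb = inj₂ (centre , inj₂ (inj₂ (inj₂ (≮⇒≥ ry≮rb))))

      diagonal-unblocked : ∀ {yᵤ yₗ} → suc (row a) ≡ row b → Down yᵤ b → Down a yₗ → ¬ yₗ ∈₃ t →
                           ¬ Blocked yᵤ
      diagonal-unblocked ra+1≡rb _ a↓yₗ yₗ∉t (_ , inj₁ c~a) =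
        yₗ∉t (inj₂ (inj₂ (Down-unique a↓yₗ (adj∧row<⇒Down (adj-sym c~a) ra<rc))))
        where
        ra<rc : row a < row c
        ra<rc = <-≤-trans (≤-reflexive ra+1≡rb) (<⇒row≤ b<c)
      diagonal-unblocked {yᵤ} _ yᵤ↓b _ _ (_ , inj₂ (inj₁ c~yᵤ)) =
        <-irrefl (cong toℕ (Down-unique yᵤ↓b (adj∧row<⇒Down (adj-sym c~yᵤ) ryᵤ<rc))) b<c
        where
        ryᵤ<rc : row yᵤ < row c
        ryᵤ<rc = <-≤-trans (≤-reflexive (proj₁ yᵤ↓b)) (<⇒row≤ b<c)
      diagonal-unblocked ra+1≡rb _ _ _ (_ , inj₂ (inj₂ (inj₁ rb≤ra))) =
        <⇒≱ (≤-reflexive ra+1≡rb) rb≤ra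
      diagonal-unblocked _ yᵤ↓b _ _ (_ , inj₂ (inj₂ (inj₂ rb≤ryᵤ))) =
        <⇒≱ (≤-reflexive (proj₁ yᵤ↓b)) rb≤ryᵤ

      twoBlocked-impossible : ∀ {y₁ y₂} → y₁ ≢ y₂ → ¬ y₁ ∈₃ t → ¬ y₂ ∈₃ t → Blocked y₁ → Blocked y₂ → ⊥
      twoBlocked-impossible {y₁} {y₂} y₁≢y₂ y₁∉t y₂∉t
                            blocked₁@((y₁~a , y₁~b) , _) blocked₂@((y₂~a , y₂~b) , _)
        with commonNeighbour a<b y₁~a y₁~b | commonNeighbour a<b y₂~a y₂~b
      ... | gap₁ , shape₁ , rb≡₁ | gap₂ , shape₂ , rb≡₂
        with +-cancelʳ-≡ (row a) gap₁ gap₂ (trans (sym rb≡₁) rb≡₂)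
      ... | refl = compare rb≡₁ shape₁ shape₂
        where
        compare : ∀ {gap} → row b ≡ gap + row a →
                  CommonNeighbour a b y₁ gap → CommonNeighbour a b y₂ gap → ⊥
        compare _ (vertical a↓y₁)   (vertical a↓y₂)   = y₁≢y₂ (Down-unique a↓y₁ a↓y₂)
        compare _ (horizontal a→y₁) (horizontal a→y₂) = y₁≢y₂ (Right-unique a→y₁ a→y₂)
        compare _ (upper y₁↓b)      (upper y₂↓b)      = y₁≢y₂ (Down-unique˘ y₁↓b y₂↓b)
        compare _ (lower a↓y₁)      (lower a↓y₂)      = y₁≢y₂ (Down-unique a↓y₁ a↓y₂)
        compare rb≡ (upper y₁↓b) (lower a↓y₂) = diagonal-unblocked (sym rb≡) y₁↓b a↓y₂ y₂∉t blocked₁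
        compare rb≡ (lower a↓y₁) (upper y₂↓b) = diagonal-unblocked (sym rb≡) y₂↓b a↓y₁ y₁∉t blocked₂

    Outcome : Triple (m * n) → Set
    Outcome s = ∃[ u ] CutTriple u × Bridge (∁ (support s)) (∁ (support t)) (∁ (support u))
                       × (key u < key t ⊎ u ≡ s)

    module Earlier {a′ b′ c′ : Vertex} (s-cut : CutTriple (a′ , b′ , c′))
                   (s≤t : key (a′ , b′ , c′) ≤ key t) where

      s : Triple (m * n)
      s = a′ , b′ , c′

      outside⇒<c : ∀ {y} → y ∈₃ s → ¬ y ∈₃ t → toℕ y < toℕ c
      outside⇒<c y∈s y∉t =
        ≤∧≢⇒< (≤-trans (∈₃⇒≤last (proj₁ s-cut) y∈s) (key≤⇒top≤ s≤t)) (y∉t ∘ inj₂ ∘ inj₂ ∘ toℕ-injective)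

      fromImprovement : ∀ {y} → y ∈₃ s → ¬ y ∈₃ t → Improvement y → Outcome s
      fromImprovement y∈s y∉t (u , u-cut , y∈u , u⊆t+y , u<t) =
        u , u-cut , bridge-support y∈s y∉t y∈u u⊆t+y , inj₁ u<t

      noStar : ∀ {w p q} → w ∈₃ s → s ⊆₃ (w , p , q) → Adj G w p → Adj G w q → ⊥
      noStar {w} {p} {q} w∈s s⊆wpq w~p w~q =
        proj₂ s-cut (star⇒connected (∈-support⁺ s w∈s) (near ∘ s⊆wpq ∘ ∈-support⁻ s))
        where
        near : ∀ {x} → x ∈₃ (w , p , q) → x ≡ w ⊎ Adj G w x
        near first  = inj₁ refl
        near second = inj₂ w~p
        near third  = inj₂ w~q

      module _ (a~b : Adj G a b) where
        open Adjacent a~b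

        square : ∀ {p q z} → Down a p → Down b q → Right a b → z ≢ p → z ≢ q →
                 (p , q , z) ⊆₃ s → s ⊆₃ (p , q , z) → Outcome s
        square {p} {q} {z} a↓p b↓q a→b z≢p z≢q into onto with z ∈₃? t
        ... | no z∉t with improveOrBlocked z∉t (outside⇒<c (into third) z∉t)
        ...   | inj₁ better           = fromImprovement (into third) z∉t better
        ...   | inj₂ (inj₁ b↓z)       = ⊥-elim (z≢q (Down-unique b↓z b↓q))
        ...   | inj₂ (inj₂ (a↓z , _)) = ⊥-elim (z≢p (Down-unique a↓z a↓p))
        square a↓p b↓q a→b _ _ into onto | yes first =
          ⊥-elim (noStar (into first) onto (step⇒adj (right (belowRight a↓p b↓q a→b))) (step⇒adj (up a↓p)))
        square a↓p b↓q a→b _ _ into onto | yes second =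
          ⊥-elim (noStar (into second) (∈₃-swap ∘ onto) (step⇒adj (left (belowRight a↓p b↓q a→b)))
                         (step⇒adj (up b↓q)))
        square a↓p b↓q (ra≡rb , _) _ _ into onto | yes third =
          ⊥-elim (<⇒≱ (subst (λ c′ → key t < key (a′ , b′ , c′)) (sym c′≡c) (key<-byRank (rank<-byRow rb<rb′)))
                      s≤t)
          where
          c′≡c : c′ ≡ c
          c′≡c = toℕ-injective (≤-antisym (key≤⇒top≤ s≤t) (∈₃⇒≤last (proj₁ s-cut) (into third)))
          rb<rb′ : row b < row b′
          rb<rb′ with onto second
          ... | first  = ≤-reflexive (trans (cong suc (sym ra≡rb)) (proj₁ a↓p))
          ... | second = ≤-reflexive (proj₁ b↓q)
          ... | third  = ⊥-elim (<-irrefl (cong toℕ (sym c′≡c)) (proj₂ (proj₁ s-cut)))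

      twoOutside⇒outcome : ∀ {y₁ y₂ z} → Distinct (y₁ , y₂ , z) → ¬ y₁ ∈₃ t → ¬ y₂ ∈₃ t →
                           (y₁ , y₂ , z) ⊆₃ s → s ⊆₃ (y₁ , y₂ , z) → Outcome s
      twoOutside⇒outcome {y₁} {y₂} {z} (y₁≢y₂ , y₁≢z , y₂≢z) y₁∉t y₂∉t into onto = byAdjacency (adj? a b)
        where
        y₁<c : toℕ y₁ < toℕ c
        y₁<c = outside⇒<c (into first) y₁∉t
        y₂<c : toℕ y₂ < toℕ c
        y₂<c = outside⇒<c (into second) y₂∉t

        adjacentCase : Adj G a b → Outcome s
        adjacentCase a~b
          with Adjacent.improveOrBlocked a~b y₁∉t y₁<c | Adjacent.improveOrBlocked a~b y₂∉t y₂<c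
        ... | inj₁ better | _           = fromImprovement (into first) y₁∉t better
        ... | inj₂ _      | inj₁ better = fromImprovement (into second) y₂∉t better
        ... | inj₂ (inj₁ b↓y₁)         | inj₂ (inj₁ b↓y₂)         = ⊥-elim (y₁≢y₂ (Down-unique b↓y₁ b↓y₂))
        ... | inj₂ (inj₂ (a↓y₁ , _))   | inj₂ (inj₂ (a↓y₂ , _))   = ⊥-elim (y₁≢y₂ (Down-unique a↓y₁ a↓y₂))
        ... | inj₂ (inj₂ (a↓y₁ , a→b)) | inj₂ (inj₁ b↓y₂)         =
          square a~b a↓y₁ b↓y₂ a→b (y₁≢z ∘ sym) (y₂≢z ∘ sym) into onto
        ... | inj₂ (inj₁ b↓y₁)         | inj₂ (inj₂ (a↓y₂ , a→b)) =
          square a~b a↓y₂ b↓y₁ a→b (y₂≢z ∘ sym) (y₁≢z ∘ sym) (into ∘ ∈₃-swap) (∈₃-swap ∘ onto)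

        nonadjacentCase : ¬ Adj G a b → Outcome s
        nonadjacentCase a≁b
          with Nonadjacent.improveOrBlocked a≁b y₁∉t y₁<c | Nonadjacent.improveOrBlocked a≁b y₂∉t y₂<c
        ... | inj₁ better   | _             = fromImprovement (into first) y₁∉t better
        ... | inj₂ _        | inj₁ better   = fromImprovement (into second) y₂∉t better
        ... | inj₂ blocked₁ | inj₂ blocked₂ =
          ⊥-elim (Nonadjacent.twoBlocked-impossible a≁b y₁≢y₂ y₁∉t y₂∉t blocked₁ blocked₂)

        byAdjacency : Dec (Adj G a b) → Outcome s
        byAdjacency (yes a~b) = adjacentCase a~b
        byAdjacency (no  a≁b) = nonadjacentCase a≁b

      outcome : support s ≢ support t → Outcome s
      outcome s≢t with classify-overlap s t (increasing⇒distinct s (proj₁ s-cut))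
      ... | contained s⊆t =
        ⊥-elim (s≢t (p⊆q∧∣p∣≡∣q∣⇒p≡q (support-⊆ s⊆t)
          (trans (∣support∣≡3 s (increasing⇒distinct s (proj₁ s-cut)))
                 (sym (∣support∣≡3 t (increasing⇒distinct t (proj₁ t-cut)))))))
      ... | oneOutside y∈s y∉t s⊆t+y = s , s-cut , bridge-support y∈s y∉t y∈s s⊆t+y , inj₂ refl
      ... | twoOutside distinct y₁∉t y₂∉t into onto = twoOutside⇒outcome distinct y₁∉t y₂∉t into onto

  exchange : ∀ {s t} → CutTriple s → CutTriple t → support s ≢ support t → key s ≤ key t →
             ∃[ u ] CutTriple u × Bridge (∁ (support s)) (∁ (support t)) (∁ (support u))
                    × (key u < key t ⊎ u ≡ s)
  exchange {a′ , b′ , c′} {a , b , c} s-cut t-cut s≢t s≤t =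
    Exchange.Earlier.outcome {a} {b} {c} t-cut {a′} {b′} {c′} s-cut s≤t s≢t

  cutTriple? : ∀ t → Dec (CutTriple t)
  cutTriple? t@(a , b , c) with (toℕ a <? toℕ b) ×-dec (toℕ b <? toℕ c)
  ... | no  ¬increasing = no (¬increasing ∘ proj₁)
  ... | yes increasing with hasCentre? t
  ...   | yes centre   = no λ t-cut → proj₂ t-cut (hasCentre⇒connected t centre)
  ...   | no  noCentre = yes (increasing , ¬hasCentre⇒disconnected t (increasing⇒distinct t increasing) noCentre)

  allTriples : List (Triple (m * n))
  allTriples = cartesianProduct (allFin (m * n)) (cartesianProduct (allFin (m * n)) (allFin (m * n)))

  private
    module ByKey = Sort (On.decTotalOrder ≤-decTotalOrder key)

  cutTriples : List (Triple (m * n))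
  cutTriples = ByKey.sort (filter cutTriple? allTriples)

  ∈-cutTriples⁺ : ∀ {t} → CutTriple t → t ∈ₗ cutTriples
  ∈-cutTriples⁺ {a , b , c} t-cut =
    ∈-resp-↭ (↭-sym (ByKey.sort-↭ _))
      (∈-filter⁺ cutTriple? (∈-cartesianProduct⁺ (∈-allFin a) (∈-cartesianProduct⁺ (∈-allFin b) (∈-allFin c)))
                 t-cut)

  ∈-cutTriples⁻ : ∀ {t} → t ∈ₗ cutTriples → CutTriple t
  ∈-cutTriples⁻ t∈ = proj₂ (∈-filter⁻ cutTriple? {xs = allTriples} (∈-resp-↭ (ByKey.sort-↭ _) t∈))

  cutTriples-unique : Unique cutTriples
  cutTriples-unique =
    Permutationₛ.Unique-resp-↭ (setoid _) (↭⇒↭ₛ (↭-sym (ByKey.sort-↭ _)))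
      (Uniqueₚ.filter⁺ cutTriple? (Uniqueₚ.cartesianProduct⁺ (Uniqueₚ.allFin⁺ _)
                                     (Uniqueₚ.cartesianProduct⁺ (Uniqueₚ.allFin⁺ _) (Uniqueₚ.allFin⁺ _))))

  cutTriples-sorted : AllPairs (λ s t → key s ≤ key t) cutTriples
  cutTriples-sorted = Linked⇒AllPairs ≤-trans (ByKey.sort-↗ _)

  facet : Triple (m * n) → Subset (m * n)
  facet t = ∁ (support t)

  facet-complete : 3 ≤ m * n → ∀ F → cutComplex 3 G F → ∃[ t ] t ∈ₗ cutTriples × facet t ≡ F
  facet-complete 3≤N F (∣F∣≡N∸3 , disconnected) with ∣p∣≡3⇒support (∁ F) ∣∁F∣≡3
    where
    ∣∁F∣≡3 : ∣ ∁ F ∣ ≡ 3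
    ∣∁F∣≡3 = trans (∣∁p∣≡n∸∣p∣ F) (trans (cong (m * n ∸_) ∣F∣≡N∸3) (m∸[m∸n]≡n 3≤N))
  ... | t , increasing , ∁F≡t =
    t , ∈-cutTriples⁺ (increasing , subst (InducedDisconnected G) ∁F≡t disconnected) ,
    trans (cong ∁ (sym ∁F≡t)) (∁-involutive F)

  facet-sound : ∀ {t} → t ∈ₗ cutTriples → cutComplex 3 G (facet t)
  facet-sound {t} t∈ with ∈-cutTriples⁻ t∈
  ... | increasing , disconnected =
    trans (∣∁p∣≡n∸∣p∣ (support t)) (cong (m * n ∸_) (∣support∣≡3 t (increasing⇒distinct t increasing))) ,
    subst (InducedDisconnected G) (sym (∁-involutive (support t))) disconnected

  facets-distinct : AllPairs (λ s t → facet s ≢ facet t) cutTriples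
  facets-distinct =
    AllPairs-weaken (λ s-cut t-cut s≢t → s≢t ∘ support-injective (proj₁ s-cut) (proj₁ t-cut) ∘ ∁-injective)
                    (All.tabulate ∈-cutTriples⁻) cutTriples-unique

  keyedExchange : KeyedExchange facet key cutTriples
  keyedExchange s∈ t∈ facet-s≢t s≤t
    with exchange (∈-cutTriples⁻ s∈) (∈-cutTriples⁻ t∈) (facet-s≢t ∘ cong ∁) s≤t
  ... | u , u-cut , bridge , earlier = u , ∈-cutTriples⁺ u-cut , bridge , earlier

  shellable : 3 ≤ m * n → Shellable (cutComplex 3 G)
  shellable 3≤N =
    map facet cutTriples ,
    isShellingOrder-map facet key cutTriples cutTriples-sorted facets-distinct keyedExchange
                        (facet-complete 3≤N) facet-sound

3≤m*n : ∀ {m n} → 2 ≤ m → m ≤ n → 3 ≤ m * n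
3≤m*n 2≤m m≤n = ≤-trans (n≤1+n 3) (*-mono-≤ 2≤m (≤-trans 2≤m m≤n))

voidComplex-shellable : ∀ {N} {Facet : Subset N → Set} → (∀ F → ¬ Facet F) → Shellable Facet
voidComplex-shellable noFacet = [] , [] , (λ F → ⊥-elim ∘ noFacet F) , (λ _ ()) , (λ ())

-- With fewer than three vertices m * n ∸ 3 = 0, so a facet F would be empty and ∁ F the whole grid.
grid1×1-connected : ∀ S → InducedConnected (gridGraph 1 1) S
grid1×1-connected S zero zero x∈S _ = here x∈S

grid1×2-connected : ∀ S → InducedConnected (gridGraph 1 2) S
grid1×2-connected S zero       zero       x∈S _   = here x∈S
grid1×2-connected S zero       (suc zero) x∈S y∈S = step x∈S (inj₂ (refl , inj₁ refl)) (here y∈S)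
grid1×2-connected S (suc zero) zero       x∈S y∈S = step x∈S (inj₂ (refl , inj₂ refl)) (here y∈S)
grid1×2-connected S (suc zero) (suc zero) x∈S _   = here x∈S

proposition5p6 : (m n : ℕ) → 1 ≤ m → m ≤ n →
    Shellable (cutComplex 3 (gridGraph m n))
proposition5p6 (suc zero) (suc zero) _ _ =
  voidComplex-shellable λ F (_ , disconnected) → disconnected (grid1×1-connected (∁ F))
proposition5p6 (suc zero) (suc (suc zero)) _ _ =
  voidComplex-shellable λ F (_ , disconnected) → disconnected (grid1×2-connected (∁ F))
proposition5p6 (suc zero) (suc (suc (suc k))) _ _ = Grid.shellable 1 (3 + k) (s≤s (s≤s (s≤s z≤n)))
proposition5p6 (suc (suc j)) n _ 2+j≤n = Grid.shellable (2 + j) n (3≤m*n (s≤s (s≤s z≤n)) 2+j≤n)
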